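{- If a connected graph $G$ contains a pan or a diamond as an induced subgraph, then there is a graph search ordering of $G$ that is not an MNS ordering of $G$.
   Context: All graphs are finite and simple. For an ordering $\sigma$ of $V(G)$ write $x<_\sigma y$ if $x$ precedes $y$. A graph search ordering of $G$ is an ordering of $V(G)$ such that every prefix induces a connected subgraph. $\sigma$ is an MNS ordering if whenever $a<_\sigma b<_\sigma c$, $ac\in E(G)$ and $ab\notin E(G)$, there is $d$ with $d<_\sigma b$, $db\in E(G)$ and $dc\notin E(G)$. For $k\ge3$ a $k$-pan is a $k$-cycle plus one extra vertex adjacent to exactly one cycle vertex; a pan is a $k$-pan for some $k\ge 3$. The diamond is $K_4$ minus one edge. -}

module Defs where

open import Data.Nat using (ℕ; zero; suc) renaming (_<_ to _<ℕ_)
open import Data.Fin using (Fin; toℕ; _<_)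
open import Data.Product using (Σ; ∃; _×_; _,_)
open import Data.Sum using (_⊎_)
open import Data.Unit using (⊤)
open import Relation.Nullary using (¬_; Dec)
open import Relation.Binary.PropositionalEquality using (_≡_; _≢_)
open import Function.Bundles using (_↔_; Inverse; _⇔_)
open import Function.Definitions using (Injective)

record Graph (n : ℕ) : Set₁ where
  field
    Adj    : Fin n → Fin n → Set
    adj?   : ∀ x y → Dec (Adj x y)
    sym    : ∀ {x y} → Adj x y → Adj y x
    irrefl : ∀ {x} → ¬ Adj x x
open Graph public

-- Walks inside a vertex set S: ReachIn G S x y means there is a path from x to y
-- all of whose vertices after x lie in S.
data ReachIn {n : ℕ} (G : Graph n) (S : Fin n → Set) : Fin n → Fin n → Set where
  here : ∀ {x} → ReachIn G S x x
  step : ∀ {x y z} → Adj G x z → S z → ReachIn G S z y → ReachIn G S x y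

ConnectedOn : {n : ℕ} → Graph n → (Fin n → Set) → Set
ConnectedOn G S = ∀ x y → S x → S y → ReachIn G S x y

Full : {n : ℕ} → Fin n → Set
Full _ = ⊤

Connected : {n : ℕ} → Graph n → Set
Connected G = ConnectedOn G Full

-- An ordering of V(G): a bijection from positions to vertices.
Ordering : ℕ → Set
Ordering n = Fin n ↔ Fin n

pos : {n : ℕ} → Ordering n → Fin n → Fin n
pos σ v = Inverse.from σ v

_<[_]_ : {n : ℕ} → Fin n → Ordering n → Fin n → Set
x <[ σ ] y = pos σ x < pos σ y

InPrefix : {n : ℕ} → Ordering n → ℕ → Fin n → Set
InPrefix σ k v = toℕ (pos σ v) <ℕ k

IsSearchOrdering : {n : ℕ} → Graph n → Ordering n → Set
IsSearchOrdering G σ = ∀ k → ConnectedOn G (InPrefix σ k)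

IsMNS : {n : ℕ} → Graph n → Ordering n → Set
IsMNS G σ = ∀ a b c → a <[ σ ] b → b <[ σ ] c → Adj G a c → ¬ Adj G a b →
  ∃ λ d → d <[ σ ] b × Adj G d b × ¬ Adj G d c

InducedIn : {m n : ℕ} → (Fin m → Fin m → Set) → Graph n → Set
InducedIn {m} {n} HAdj G = Σ (Fin m → Fin n) λ f →
  Injective _≡_ _≡_ f × (∀ x y → HAdj x y ⇔ Adj G (f x) (f y))

CycleAdj : ℕ → ℕ → ℕ → Set
CycleAdj k i j = (suc i ≡ j) ⊎ (suc j ≡ i) ⊎ (i ≡ 0 × suc j ≡ k) ⊎ (j ≡ 0 × suc i ≡ k)

-- k-pan on Fin (suc k): cycle 0,…,k-1 plus vertex k adjacent only to 0
PanAdj : (k : ℕ) → Fin (suc k) → Fin (suc k) → Set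
PanAdj k x y =
  (toℕ x <ℕ k × toℕ y <ℕ k × CycleAdj k (toℕ x) (toℕ y))
  ⊎ (toℕ x ≡ 0 × toℕ y ≡ k) ⊎ (toℕ x ≡ k × toℕ y ≡ 0)

DiamondAdj : Fin 4 → Fin 4 → Set
DiamondAdj x y = x ≢ y × ¬ (toℕ x ≡ 0 × toℕ y ≡ 3) × ¬ (toℕ x ≡ 3 × toℕ y ≡ 0)

{-# OPTIONS --safe #-}
module Submission where

-- A search that starts a, …, b, …, c with ac an edge, ab a non-edge, and every
-- earlier neighbour of b also adjacent to c, can have no MNS witness d for the
-- triple (a, b, c); and in a connected graph every start in which each vertex
-- has an earlier neighbour extends to a full search ordering, by repeatedly
-- appending a vertex adjacent to the visited set.  In a pan with cycle
-- u₀ … u_{k-1} and pendant v at u₀, start u₀, …, u_{k-2}, v, u_{k-1} and take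
-- (a, b, c) = (u_{k-2}, v, u_{k-1}): the only earlier neighbour of v is u₀, which
-- is adjacent to u_{k-1}.  In the diamond with non-edge 03, start 1, 0, 3, 2 and
-- take (a, b, c) = (0, 3, 2).

open import Defs hiding (sym)
open import Data.Nat using (ℕ; zero; suc; _+_; _≤_; _<_; z≤n; s≤s; z<s; _≟_)
open import Data.Nat.Properties
open import Data.Nat.Induction using (<-rec)
open import Data.Fin using (Fin; zero; suc; toℕ; fromℕ<)
open import Data.Fin.Patterns using (0F; 1F; 2F; 3F)
open import Data.Fin.Properties
  using (toℕ-injective; toℕ-fromℕ<; toℕ<n; all?; ¬∀⟶∃¬; injective⇒≤)
  renaming (_≟_ to _≟ᶠ_; suc-injective to fsuc-injective)
open import Data.Product using (Σ; ∃; _×_; _,_; proj₁; proj₂)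
open import Data.Sum using (_⊎_; inj₁; inj₂)
open import Data.Unit using (tt)
open import Relation.Nullary using (¬_; Dec; yes; no; contradiction; ¬?)
open import Relation.Nullary.Decidable using (from-yes; from-no; _×-dec_)
open import Relation.Binary.PropositionalEquality
  using (_≡_; refl; sym; trans; cong; subst; subst₂)
open import Function.Base using (_∘_)
open import Function.Bundles using (_⇔_; Equivalence; mk↔ₛ′)
open import Function.Definitions using (Injective)

module _ {A : Set} where

  Distinct : (ℕ → A) → ℕ → Set
  Distinct g m = ∀ {i j} → i < m → j < m → g i ≡ g j → i ≡ j

  EarlierNeighbours : (A → A → Set) → (ℕ → A) → ℕ → Set
  EarlierNeighbours E g m = ∀ {i} → i < m → 0 < i → ∃ λ j → j < i × E (g i) (g j)

  Distinct-of-retraction : ∀ {g m} (r : A → ℕ) → (∀ {i} → i < m → r (g i) ≡ i) → Distinct g m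
  Distinct-of-retraction r r∘g i<m j<m e = trans (sym (r∘g i<m)) (trans (cong r e) (r∘g j<m))

record MNSViolatingPrefix {A : Set} (E : A → A → Set) : Set where
  field
    len         : ℕ
    seq         : ℕ → A
    distinct    : Distinct seq len
    linked      : EarlierNeighbours E seq len
    a b c       : ℕ
    a<b         : a < b
    b<c         : b < c
    c<len       : c < len
    ac          : E (seq a) (seq c)
    ¬ab         : ¬ E (seq a) (seq b)
    b-nbr⇒c-nbr : ∀ {i} → i < b → E (seq i) (seq b) → E (seq i) (seq c)

map-MNSViolatingPrefix : ∀ {A B : Set} {E : A → A → Set} {F : B → B → Set} (f : A → B) →
  Injective _≡_ _≡_ f → (∀ x y → E x y ⇔ F (f x) (f y)) →
  MNSViolatingPrefix E → MNSViolatingPrefix F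
map-MNSViolatingPrefix {E = E} {F} f f-inj f-iso P = record
  { len = len ; seq = f ∘ seq
  ; distinct = λ i<len j<len e → distinct i<len j<len (f-inj e)
  ; linked = λ i<len 0<i → let j , j<i , e = linked i<len 0<i in j , j<i , to e
  ; a = a ; b = b ; c = c ; a<b = a<b ; b<c = b<c ; c<len = c<len
  ; ac = to ac ; ¬ab = ¬ab ∘ from
  ; b-nbr⇒c-nbr = λ i<b e → to (b-nbr⇒c-nbr i<b (from e))
  }
  where
  open MNSViolatingPrefix P
  to : ∀ {x y} → E x y → F (f x) (f y)
  to {x} {y} = Equivalence.to (f-iso x y)
  from : ∀ {x y} → F (f x) (f y) → E x y
  from {x} {y} = Equivalence.from (f-iso x y)

module _ {n : ℕ} (G : Graph n) where

  reach-trans : ∀ {S x y z} → ReachIn G S x y → ReachIn G S y z → ReachIn G S x z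
  reach-trans here q = q
  reach-trans (step e s p) q = step e s (reach-trans p q)

  reach-sym : ∀ {S x y} → S x → ReachIn G S x y → ReachIn G S y x
  reach-sym sx p = go sx p here
    where
    go : ∀ {S x y w} → S x → ReachIn G S x y → ReachIn G S x w → ReachIn G S y w
    go sx here acc = acc
    go sx (step e sz p) acc = go sz p (step (Graph.sym G e) sx acc)

  Occurs : (ℕ → Fin n) → ℕ → Fin n → Set
  Occurs g m v = ∃ λ j → j < m × g j ≡ v

  occurs? : ∀ g m v → Dec (Occurs g m v)
  occurs? g m v = anyUpTo? (λ j → g j ≟ᶠ v) m

  distinct⇒≤ : ∀ {g m} → Distinct g m → m ≤ n
  distinct⇒≤ dist = injective⇒≤ λ {i} {j} e → toℕ-injective (dist (toℕ<n i) (toℕ<n j) e)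

  covering⇒≥ : ∀ {g m} → (∀ v → Occurs g m v) → n ≤ m
  covering⇒≥ {g} {m} covers = injective⇒≤ index-injective
    where
    index : Fin n → Fin m
    index v = fromℕ< (proj₁ (proj₂ (covers v)))
    g∘index : ∀ v → g (toℕ (index v)) ≡ v
    g∘index v = trans (cong g (toℕ-fromℕ< _)) (proj₂ (proj₂ (covers v)))
    index-injective : Injective _≡_ _≡_ index
    index-injective {v} {w} e = trans (sym (g∘index v)) (trans (cong (g ∘ toℕ) e) (g∘index w))

  exitEdge : ∀ {g m u v} → ReachIn G Full u v → Occurs g m u → ¬ Occurs g m v →
    ∃ λ w → ¬ Occurs g m w × ∃ λ j → j < m × Adj G w (g j)
  exitEdge here ou ¬ov = contradiction ou ¬ov
  exitEdge {g} {m} (step {z = z} e _ p) (j , j<m , refl) ¬ov with occurs? g m z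
  ... | yes oz = exitEdge p oz ¬ov
  ... | no ¬oz = z , ¬oz , j , j<m , Graph.sym G e

  _[_]≔_ : (ℕ → Fin n) → ℕ → Fin n → ℕ → Fin n
  (g [ m ]≔ w) i with i ≟ m
  ... | yes _ = w
  ... | no  _ = g i

  []≔-< : ∀ g {m} w {i} → i < m → (g [ m ]≔ w) i ≡ g i
  []≔-< g {m} w {i} i<m with i ≟ m
  ... | yes refl = contradiction i<m (<-irrefl refl)
  ... | no  _    = refl

  []≔-≡ : ∀ g m w → (g [ m ]≔ w) m ≡ w
  []≔-≡ g m w with m ≟ m
  ... | yes _   = refl
  ... | no  m≢m = contradiction refl m≢m

  []≔-distinct : ∀ {g m w} → ¬ Occurs g m w → Distinct g m → Distinct (g [ m ]≔ w) (suc m)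
  []≔-distinct {g} {m} {w} new dist {i} {j} i<1+m j<1+m e
    with m<1+n⇒m<n∨m≡n i<1+m | m<1+n⇒m<n∨m≡n j<1+m
  ... | inj₁ i<m  | inj₁ j<m  = dist i<m j<m (trans (sym ([]≔-< g w i<m)) (trans e ([]≔-< g w j<m)))
  ... | inj₁ i<m  | inj₂ refl = contradiction (i , i<m , trans (sym ([]≔-< g w i<m)) (trans e ([]≔-≡ g m w))) new
  ... | inj₂ refl | inj₁ j<m  = contradiction (j , j<m , trans (sym ([]≔-< g w j<m)) (trans (sym e) ([]≔-≡ g m w))) new
  ... | inj₂ refl | inj₂ refl = refl

  []≔-linked : ∀ {g m w j} → j < m → Adj G w (g j) →
    EarlierNeighbours (Adj G) g m → EarlierNeighbours (Adj G) (g [ m ]≔ w) (suc m)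
  []≔-linked {g} {m} {w} {j} j<m e lnk {i} i<1+m 0<i with m<1+n⇒m<n∨m≡n i<1+m
  ... | inj₁ i<m =
    let k , k<i , e′ = lnk i<m 0<i
    in k , k<i , subst₂ (Adj G) (sym ([]≔-< g w i<m)) (sym ([]≔-< g w (<-trans k<i i<m))) e′
  ... | inj₂ refl = j , j<m , subst₂ (Adj G) (sym ([]≔-≡ g m w)) (sym ([]≔-< g w j<m)) e

  record Completion (g : ℕ → Fin n) (m : ℕ) : Set where
    field
      seq      : ℕ → Fin n
      agrees   : ∀ {i} → i < m → seq i ≡ g i
      distinct : Distinct seq n
      linked   : EarlierNeighbours (Adj G) seq n
      covers   : ∀ v → Occurs seq n v

  completion-of-covering : ∀ {g m} → Distinct g m → EarlierNeighbours (Adj G) g m →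
    (∀ v → Occurs g m v) → Completion g m
  completion-of-covering dist lnk covers with ≤-antisym (distinct⇒≤ dist) (covering⇒≥ covers)
  ... | refl = record { seq = _ ; agrees = λ _ → refl ; distinct = dist ; linked = lnk ; covers = covers }

  completion-[]≔ : ∀ {g m w} → Completion (g [ m ]≔ w) (suc m) → Completion g m
  completion-[]≔ {g} {m} {w} C = record
    { seq = seq ; distinct = distinct ; linked = linked ; covers = covers
    ; agrees = λ i<m → trans (agrees (m<n⇒m<1+n i<m)) ([]≔-< g w i<m)
    }
    where open Completion C

  complete : Connected G → ∀ fuel {g m} → n ≤ fuel + m → 0 < m →
    Distinct g m → EarlierNeighbours (Adj G) g m → Completion g m
  complete conn fuel {g} {m} n≤ 0<m dist lnk with all? (occurs? g m)
  ... | yes covers = completion-of-covering dist lnk covers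
  ... | no ¬covers with ¬∀⟶∃¬ n _ (occurs? g m) ¬covers
  ... | v , ¬ov with exitEdge (conn (g 0) v tt tt) (0 , 0<m , refl) ¬ov
  ... | w , ¬ow , j , j<m , e with fuel
  ... | zero     = contradiction (≤-trans (distinct⇒≤ ([]≔-distinct ¬ow dist)) n≤) 1+n≰n
  ... | suc fuel = completion-[]≔ (complete conn fuel (subst (n ≤_) (sym (+-suc fuel m)) n≤)
                     (m<n⇒m<1+n 0<m) ([]≔-distinct ¬ow dist) ([]≔-linked j<m e lnk))

  module _ {g m} (C : Completion g m) where
    open Completion C

    index : Fin n → Fin n
    index v = fromℕ< (proj₁ (proj₂ (covers v)))

    seq∘index : ∀ v → seq (toℕ (index v)) ≡ v
    seq∘index v = trans (cong seq (toℕ-fromℕ< _)) (proj₂ (proj₂ (covers v)))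

    index∘seq : ∀ {i} → i < n → toℕ (index (seq i)) ≡ i
    index∘seq i<n = distinct (toℕ<n _) i<n (seq∘index (seq _))

    ordering : Ordering n
    ordering = mk↔ₛ′ (seq ∘ toℕ) index seq∘index (λ i → toℕ-injective (index∘seq (toℕ<n i)))

    reach-seq₀ : ∀ k i → i < n → i < k → ReachIn G (InPrefix ordering k) (seq i) (seq 0)
    reach-seq₀ k = <-rec _ go
      where
      go : ∀ i → (∀ {j} → j < i → j < n → j < k → ReachIn G (InPrefix ordering k) (seq j) (seq 0)) →
        i < n → i < k → ReachIn G (InPrefix ordering k) (seq i) (seq 0)
      go zero    _   _   _   = here
      go (suc i) rec i<n i<k with linked i<n z<s
      ... | j , j<i , e = step e j-in-prefix (rec j<i j<n (<-trans j<i i<k))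
        where
        j<n = <-trans j<i i<n
        j-in-prefix : InPrefix ordering k (seq j)
        j-in-prefix = subst (_< k) (sym (index∘seq j<n)) (<-trans j<i i<k)

    ordering-isSearch : IsSearchOrdering G ordering
    ordering-isSearch k x y x-in y-in = reach-trans (to-seq₀ x x-in) (reach-sym y-in (to-seq₀ y y-in))
      where
      to-seq₀ : ∀ v → InPrefix ordering k v → ReachIn G (InPrefix ordering k) v (seq 0)
      to-seq₀ v v-in = subst (λ u → ReachIn G (InPrefix ordering k) u (seq 0)) (seq∘index v)
        (reach-seq₀ k _ (toℕ<n _) v-in)

  record SearchOrderingStartingWith (g : ℕ → Fin n) (m : ℕ) : Set where
    field
      σ       : Ordering n
      search  : IsSearchOrdering G σ
      pos-seq : ∀ {i} → i < m → toℕ (pos σ (g i)) ≡ i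
      seq-pos : ∀ v → toℕ (pos σ v) < m → v ≡ g (toℕ (pos σ v))

  searchOrderingStartingWith : Connected G → ∀ {g m} → 0 < m →
    Distinct g m → EarlierNeighbours (Adj G) g m → SearchOrderingStartingWith g m
  searchOrderingStartingWith conn {g} {m} 0<m dist lnk = record
    { σ = ordering C
    ; search = ordering-isSearch C
    ; pos-seq = λ i<m → trans (cong (toℕ ∘ index C) (sym (agrees i<m)))
                              (index∘seq C (<-≤-trans i<m (distinct⇒≤ dist)))
    ; seq-pos = λ v p<m → trans (sym (seq∘index C v)) (agrees p<m)
    }
    where
    C = complete conn n (m≤m+n n m) 0<m dist lnk
    open Completion C

  ¬MNS-searchOrdering : Connected G → MNSViolatingPrefix (Adj G) →
    Σ (Ordering n) λ σ → IsSearchOrdering G σ × ¬ IsMNS G σ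
  ¬MNS-searchOrdering conn P = σ , search , ¬mns
    where
    open MNSViolatingPrefix P
    b<len = <-trans b<c c<len
    open SearchOrderingStartingWith
      (searchOrderingStartingWith conn (≤-<-trans z≤n (<-trans a<b b<len)) distinct linked)

    precedes : ∀ {i j} → i < j → j < len → seq i <[ σ ] seq j
    precedes i<j j<len = subst₂ _<_ (sym (pos-seq (<-trans i<j j<len))) (sym (pos-seq j<len)) i<j

    ¬mns : ¬ IsMNS G σ
    ¬mns mns with mns (seq a) (seq b) (seq c) (precedes a<b b<len) (precedes b<c c<len) ac ¬ab
    ... | d , d<b , db , ¬dc = ¬dc (subst (λ u → Adj G u (seq c)) (sym d≡seq-i)
                                     (b-nbr⇒c-nbr i<b (subst (λ u → Adj G u (seq b)) d≡seq-i db)))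
      where
      i<b = subst (toℕ (pos σ d) <_) (pos-seq b<len) d<b
      d≡seq-i = seq-pos d (<-trans i<b b<len)

pan-succ : ∀ {k} {x y : Fin (suc k)} → suc (toℕ x) ≡ toℕ y → toℕ y < k → PanAdj k x y
pan-succ x+1≡y y<k = inj₁ (<-trans (≤-reflexive x+1≡y) y<k , y<k , inj₁ x+1≡y)

pan-pred : ∀ {k} {x y : Fin (suc k)} → suc (toℕ y) ≡ toℕ x → toℕ x < k → PanAdj k x y
pan-pred y+1≡x x<k = inj₁ (x<k , <-trans (≤-reflexive y+1≡x) x<k , inj₂ (inj₁ y+1≡x))

pan-wrap : ∀ {k} {x y : Fin (suc k)} → toℕ x ≡ 0 → suc (toℕ y) ≡ k → PanAdj k x y
pan-wrap {k} x≡0 y+1≡k =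
  inj₁ (subst (_< k) (sym x≡0) (≤-trans (s≤s z≤n) (≤-reflexive y+1≡k)) , ≤-reflexive y+1≡k ,
        inj₂ (inj₂ (inj₁ (x≡0 , y+1≡k))))

pan-pendant : ∀ {k} {x y : Fin (suc k)} → toℕ y ≡ k → PanAdj k x y → toℕ x ≡ 0
pan-pendant y≡k (inj₁ (_ , y<k , _))        = contradiction y≡k (<⇒≢ y<k)
pan-pendant _   (inj₂ (inj₁ (x≡0 , _)))     = x≡0
pan-pendant y≡k (inj₂ (inj₂ (x≡k , y≡0)))   = trans x≡k (trans (sym y≡k) y≡0)

-- In the (p + 1)-pan the pendant is p + 1; panOrder p visits it just before
-- the last cycle vertex p.
panOrder : ∀ p → ℕ → Fin (suc (suc p))
panOrder zero    zero    = 1F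
panOrder zero    (suc _) = 0F
panOrder (suc p) zero    = 0F
panOrder (suc p) (suc i) = suc (panOrder p i)

panOrder-< : ∀ {p i} → i < p → toℕ (panOrder p i) ≡ i
panOrder-< {suc p} {zero}  _         = refl
panOrder-< {suc p} {suc i} (s≤s i<p) = cong suc (panOrder-< i<p)

panOrder-pendant : ∀ p → toℕ (panOrder p p) ≡ suc p
panOrder-pendant zero    = refl
panOrder-pendant (suc p) = cong suc (panOrder-pendant p)

panOrder-last : ∀ p → toℕ (panOrder p (suc p)) ≡ p
panOrder-last zero    = refl
panOrder-last (suc p) = cong suc (panOrder-last p)

panOrder-distinct : ∀ p → Distinct (panOrder p) (suc (suc p))
panOrder-distinct zero    {0} {0} _ _ _ = refl
panOrder-distinct zero    {0} {1} _ _ ()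
panOrder-distinct zero    {1} {0} _ _ ()
panOrder-distinct zero    {1} {1} _ _ _ = refl
panOrder-distinct zero    {suc (suc _)} (s≤s (s≤s ())) _
panOrder-distinct zero    {_} {suc (suc _)} _ (s≤s (s≤s ()))
panOrder-distinct (suc p) {zero}  {zero}  _ _ _ = refl
panOrder-distinct (suc p) {zero}  {suc _} _ _ ()
panOrder-distinct (suc p) {suc _} {zero}  _ _ ()
panOrder-distinct (suc p) {suc i} {suc j} (s≤s i<) (s≤s j<) e =
  cong suc (panOrder-distinct p i< j< (fsuc-injective e))

panPrefix : ∀ {k} → 3 ≤ k → MNSViolatingPrefix (PanAdj k)
panPrefix {suc (suc (suc q))} (s≤s (s≤s (s≤s _))) = record
  { len = suc (suc p) ; seq = panOrder p ; distinct = panOrder-distinct p ; linked = linked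
  ; a = suc q ; b = p ; c = suc p ; a<b = ≤-refl ; b<c = ≤-refl ; c<len = ≤-refl
  ; ac = pan-succ (trans (cong suc a-index) (sym (panOrder-last p)))
                  (subst (_< suc p) (sym (panOrder-last p)) ≤-refl)
  ; ¬ab = λ e → contradiction (trans (sym a-index) (pan-pendant (panOrder-pendant p) e)) λ ()
  ; b-nbr⇒c-nbr = λ _ e → pan-wrap (pan-pendant (panOrder-pendant p) e) (cong suc (panOrder-last p))
  }
  where
  p = suc (suc q)
  a-index : toℕ (panOrder p (suc q)) ≡ suc q
  a-index = panOrder-< ≤-refl
  linked : EarlierNeighbours (PanAdj (suc p)) (panOrder p) (suc (suc p))
  linked {i} i<len 0<i with m<1+n⇒m<n∨m≡n i<len
  linked {suc i} _ _ | inj₁ i<1+p with m<1+n⇒m<n∨m≡n i<1+p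
  ... | inj₁ i+1<p = i , ≤-refl ,
        pan-pred (trans (cong suc (panOrder-< (<-trans ≤-refl i+1<p))) (sym (panOrder-< i+1<p)))
                 (subst (_< suc p) (sym (panOrder-< i+1<p)) (<-trans i+1<p ≤-refl))
  ... | inj₂ refl = 0 , z<s , inj₂ (inj₂ (panOrder-pendant p , refl))
  linked {suc i} _ _ | inj₂ refl = suc q , m<n⇒m<1+n ≤-refl ,
        pan-pred (trans (cong suc a-index) (sym (panOrder-last p)))
                 (subst (_< suc p) (sym (panOrder-last p)) ≤-refl)

diamondAdj? : ∀ x y → Dec (DiamondAdj x y)
diamondAdj? x y =
  ¬? (x ≟ᶠ y) ×-dec ¬? (toℕ x ≟ 0 ×-dec toℕ y ≟ 3) ×-dec ¬? (toℕ x ≟ 3 ×-dec toℕ y ≟ 0)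

diamondOrder : ℕ → Fin 4
diamondOrder 0 = 1F
diamondOrder 1 = 0F
diamondOrder 2 = 3F
diamondOrder _ = 2F

diamondIndex : Fin 4 → ℕ
diamondIndex 0F = 1
diamondIndex 1F = 0
diamondIndex 2F = 3
diamondIndex 3F = 2

diamondIndex∘diamondOrder : ∀ {i} → i < 4 → diamondIndex (diamondOrder i) ≡ i
diamondIndex∘diamondOrder {0} _ = refl
diamondIndex∘diamondOrder {1} _ = refl
diamondIndex∘diamondOrder {2} _ = refl
diamondIndex∘diamondOrder {3} _ = refl
diamondIndex∘diamondOrder {suc (suc (suc (suc _)))} (s≤s (s≤s (s≤s (s≤s ()))))

diamondPrefix : MNSViolatingPrefix DiamondAdj
diamondPrefix = record
  { len = 4 ; seq = diamondOrder
  ; distinct = Distinct-of-retraction diamondIndex diamondIndex∘diamondOrder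
  ; linked = linked
  ; a = 1 ; b = 2 ; c = 3 ; a<b = ≤-refl ; b<c = ≤-refl ; c<len = ≤-refl
  ; ac = from-yes (diamondAdj? 0F 2F)
  ; ¬ab = from-no (diamondAdj? 0F 3F)
  ; b-nbr⇒c-nbr = b-nbr⇒c-nbr
  }
  where
  linked : EarlierNeighbours DiamondAdj diamondOrder 4
  linked {1} _ _ = 0 , z<s , from-yes (diamondAdj? 0F 1F)
  linked {2} _ _ = 0 , z<s , from-yes (diamondAdj? 3F 1F)
  linked {3} _ _ = 0 , z<s , from-yes (diamondAdj? 2F 1F)
  linked {suc (suc (suc (suc _)))} (s≤s (s≤s (s≤s (s≤s ())))) _
  b-nbr⇒c-nbr : ∀ {i} → i < 2 → DiamondAdj (diamondOrder i) 3F → DiamondAdj (diamondOrder i) 2F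
  b-nbr⇒c-nbr {0} _ _ = from-yes (diamondAdj? 1F 2F)
  b-nbr⇒c-nbr {1} _ e = contradiction e (from-no (diamondAdj? 0F 3F))
  b-nbr⇒c-nbr {suc (suc _)} (s≤s (s≤s ()))

lemma9 : {n : ℕ} (G : Graph n) → Connected G →
    ((Σ ℕ λ k → 3 ≤ k × InducedIn (PanAdj k) G) ⊎ InducedIn DiamondAdj G) →
    Σ (Ordering n) λ σ → IsSearchOrdering G σ × ¬ IsMNS G σ
lemma9 G conn (inj₁ (_ , 3≤k , f , f-inj , f-iso)) =
  ¬MNS-searchOrdering G conn (map-MNSViolatingPrefix f f-inj f-iso (panPrefix 3≤k))
lemma9 G conn (inj₂ (f , f-inj , f-iso)) =
  ¬MNS-searchOrdering G conn (map-MNSViolatingPrefix f f-inj f-iso diamondPrefix)
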